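{- Let $N$ be a level-$2$ network on $X$ without cherries and with at least two pendant blobs, and let $A\subseteq X$. Then $N$ contains a pendant blob whose set of contained leaves is exactly $A$ if and only if $A|(X\setminus A)$ is a non-trivial split induced by a cut-edge of $N$ such that there is no non-trivial cut-edge induced split $A'|B'$ of $N$ with $A'\subsetneq A$.
   Context: A network on a finite set $X$ with $|X|\ge 2$ is a finite, simple, connected, undirected, unweighted graph with at least two degree-$1$ vertices (leaves), leaves bijectively labelled by $X$, all other vertices of degree $3$; standing assumption: every cut-edge separates $X$ into two non-empty parts and distinct cut-edges induce distinct bipartitions. A cut-edge induces the split $A|B$ of $X$ given by the leaves of the two components after its removal; a split is non-trivial if both parts have at least two elements. A cherry is a pair of leaves with a common neighbour. A blob is a maximal $2$-connected subgraph with at least three vertices; level-$2$ means at most $2$ edges must be deleted from each blob to obtain a tree. A cut-edge is trivial if it is incident to a leaf, non-trivial otherwise; an edge is incident to a blob if exactly one endpoint lies in the blob; a blob is pendant if exactly one non-trivial cut-edge is incident to it. A leaf is contained in a blob if its neighbour is a vertex of the blob. -}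

module Defs where

open import Data.Nat using (ℕ; zero; suc; _+_; _≤_)
open import Data.Fin using (Fin)
open import Data.Fin.Subset using (Subset; _∈_; _∉_; _⊆_; ∣_∣)
open import Data.Bool using (Bool; true; false; T; if_then_else_)
open import Data.List using (List; length; map; allFin)
open import Data.Nat.ListAction using (sum)
open import Data.List.Membership.Propositional using () renaming (_∈_ to _∈ˡ_)
open import Data.Product using (Σ; ∃; ∃-syntax; _×_; _,_)
open import Data.Sum using (_⊎_)
open import Relation.Nullary using (¬_)
open import Relation.Binary.PropositionalEquality using (_≡_; _≢_)

Rel : ℕ → Set₁
Rel n = Fin n → Fin n → Set

data Reach {n : ℕ} (E : Rel n) : Fin n → Fin n → Set where
  here : ∀ {u} → Reach E u u
  step : ∀ {u v w} → E u v → Reach E v w → Reach E u w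

SameEdge : ∀ {n} → Fin n → Fin n → Fin n → Fin n → Set
SameEdge a b u v = (a ≡ u × b ≡ v) ⊎ (a ≡ v × b ≡ u)

DelEdge : ∀ {n} → Rel n → Fin n → Fin n → Rel n
DelEdge E u v a b = E a b × ¬ SameEdge a b u v

DelEdges : ∀ {n} → Rel n → List (Fin n × Fin n) → Rel n
DelEdges E F a b = E a b × (∀ u v → (u , v) ∈ˡ F → ¬ SameEdge a b u v)

Connected : ∀ {n} → (Fin n → Set) → Rel n → Set
Connected V E = ∀ a b → V a → V b → Reach E a b

-- A tree: connected, and acyclic in the sense that every edge is a cut-edge
-- (minimally connected graph).
IsTree : ∀ {n} → (Fin n → Set) → Rel n → Set
IsTree V E = Connected V E × (∀ a b → E a b → ¬ Reach (DelEdge E a b) a b)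

AtLeastTwo : ∀ {m} → (Fin m → Set) → Set
AtLeastTwo P = ∃[ x ] ∃[ y ] (x ≢ y × P x × P y)

StrictSub : ∀ {m} → (Fin m → Set) → Subset m → Set
StrictSub P A = (∀ x → P x → x ∈ A) × (∃[ x ] (x ∈ A × ¬ P x))

record Network (m : ℕ) : Set where
  field
    n      : ℕ
    adj    : Fin n → Fin n → Bool
    sym    : ∀ u v → adj u v ≡ adj v u
    irrefl : ∀ u → adj u u ≡ false
  Adj : Rel n
  Adj u v = T (adj u v)
  degree : Fin n → ℕ
  degree v = sum (map (λ w → if adj v w then 1 else 0) (allFin n))
  CutEdge : Fin n → Fin n → Set
  CutEdge u v = Adj u v × ¬ Reach (DelEdge Adj u v) u v
  field
    leaf      : Fin m → Fin n
    two≤m     : 2 ≤ m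
    leaf-inj  : ∀ x y → leaf x ≡ leaf y → x ≡ y
    leaf-deg  : ∀ x → degree (leaf x) ≡ 1
    other-deg : ∀ v → (∀ x → leaf x ≢ v) → degree v ≡ 3
    connected : ∀ u v → Reach Adj u v
  Side : Fin n → Fin n → Fin m → Set
  Side u v x = Reach (DelEdge Adj u v) u (leaf x)
  field
    -- standing assumption: both parts of a cut-edge split are non-empty
    cut-nonempty : ∀ u v → CutEdge u v → ∃[ x ] Side u v x
    -- standing assumption: distinct cut-edges induce distinct bipartitions
    cut-distinct : ∀ u v u' v' → CutEdge u v → CutEdge u' v' →
                   (∀ x → (Side u v x → Side u' v' x) × (Side u' v' x → Side u v x)) →
                   u ≡ u' × v ≡ v'
  IsLeaf : Fin n → Set
  IsLeaf v = ∃[ x ] leaf x ≡ v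
  NonTrivCut : Fin n → Fin n → Set
  NonTrivCut u v = CutEdge u v × ¬ IsLeaf u × ¬ IsLeaf v
  Induced : Subset n → Rel n
  Induced S a b = Adj a b × a ∈ S × b ∈ S
  Minus : Subset n → Fin n → Fin n → Set
  Minus S w a = a ∈ S × a ≢ w
  TwoConnected : Subset n → Set
  TwoConnected S =
    3 ≤ ∣ S ∣ × Connected (_∈ S) (Induced S) ×
    (∀ w → w ∈ S → Connected (Minus S w)
       (λ a b → Induced S a b × Minus S w a × Minus S w b))
  -- a blob, represented by its vertex set (maximal 2-connected subgraphs are induced)
  Blob : Subset n → Set
  Blob S = TwoConnected S × (∀ S' → S ⊆ S' → TwoConnected S' → S' ⊆ S)
  Level2 : Set
  Level2 = ∀ S → Blob S → ∃[ F ] (length F ≤ 2 × IsTree (_∈ S) (DelEdges (Induced S) F))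
  PendantBlob : Subset n → Set
  PendantBlob S = Blob S × ∃[ u ] ∃[ v ] ((u ∈ S × v ∉ S × NonTrivCut u v) ×
    (∀ u' v' → u' ∈ S → v' ∉ S → NonTrivCut u' v' → u' ≡ u × v' ≡ v))
  ContainedIn : Fin m → Subset n → Set
  ContainedIn x S = ∃[ w ] (Adj (leaf x) w × w ∈ S)
  NoCherries : Set
  NoCherries = ¬ (∃[ x ] ∃[ y ] ∃[ w ] (x ≢ y × Adj (leaf x) w × Adj (leaf y) w))
  AtLeastTwoPendant : Set
  AtLeastTwoPendant = ∃[ S₁ ] ∃[ S₂ ] (S₁ ≢ S₂ × PendantBlob S₁ × PendantBlob S₂)

-- A pendant blob S with its non-trivial cut-edge uv is, together with its pendant leaves, exactly the
-- u-side of uv: an edge leaving a blob is a cut-edge, so any other edge leaving S must end in a leaf.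
-- Hence the leaves in S form the split of uv; a second pendant blob provides two leaves on the other
-- side, and a smaller split would need a cut-edge at S, impossible inside a 2-connected set.
-- Conversely, for a minimal non-trivial split of a cut-edge uv, take S to be the non-leaf vertices on
-- u's side.  No edge between them is a cut-edge (its far side would give a smaller split), which with
-- all degrees 3 and no cherries makes S 2-connected; any larger 2-connected set would contain uv.
module Submission where

open import Defs
open import Data.Nat using (ℕ; zero; suc; _+_; _≤_; s≤s; z≤n; _∸_)
open import Data.Nat.Properties using (≤-trans; ≤-reflexive; m∸n+n≡m; +-monoʳ-≤; n≤1+n; +-suc; <⇒≱)
open import Data.Fin using (Fin)
open import Data.Fin.Properties using (_≟_; any?)
open import Data.Fin.Subset using (Subset; _∈_; _∉_; _⊆_; ∣_∣; _∪_; ⁅_⁆; _-_)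
open import Data.Fin.Subset.Properties
  using (_∈?_; ⊆-antisym; x∈p∪q⁺; x∈⁅x⁆; p⊆q⇒∣p∣≤∣q∣; ∣⁅x⁆∣≡1; x∈p⇒∣p-x∣<∣p∣; x∈p∧x≢y⇒x∈p-y)
open import Data.Bool using (Bool; true; false; T; if_then_else_)
open import Data.Vec using (_∷_; [])
open import Data.List using (List; []; _∷_; length; allFin; map; filterᵇ)
open import Data.Nat.ListAction using (sum)
open import Data.List.Properties using (length-tabulate)
open import Data.List.Membership.Propositional using () renaming (_∈_ to _∈ˡ_)
open import Data.List.Membership.Propositional.Properties using (∈-allFin; ∈-filter⁺; ∈-filter⁻)
open import Data.List.Relation.Unary.Any using (here; there) renaming (any? to anyˡ?)
open import Data.List.Relation.Unary.All as All using ([]; _∷_)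
open import Data.List.Relation.Unary.All.Properties using (¬Any⇒All¬)
open import Data.List.Relation.Unary.AllPairs using ([]; _∷_)
open import Data.List.Relation.Unary.Unique.Propositional using (Unique)
open import Data.List.Relation.Unary.Unique.Propositional.Properties using (filter⁺; allFin⁺)
import Data.Vec as Vec
open import Data.Vec.Properties using (lookup∘tabulate; lookup⇒[]=; []=⇒lookup; ≡-dec)
import Data.Bool.Properties as Bool
open import Data.Product using (∃-syntax; _×_; _,_; proj₁; proj₂)
open import Data.Sum using (_⊎_; inj₁; inj₂)
open import Data.Empty using (⊥; ⊥-elim)
open import Function using (_∘_; case_of_)
open import Function.Bundles using (_⇔_; mk⇔)
open import Relation.Nullary using (¬_; Dec; yes; no; does)
open import Relation.Nullary.Decidable using (_×-dec_; _⊎-dec_; ¬?; T?)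
open import Relation.Unary using (Decidable)
open import Relation.Binary.PropositionalEquality
  using (_≡_; _≢_; refl; sym; trans; cong; cong₂; subst; ≢-sym)

module _ {A : Set} where

  ∈-remove : ∀ {x : A} (xs : List A) → x ∈ˡ xs →
             ∃[ ys ] (length xs ≡ suc (length ys) × (∀ {y : A} → y ∈ˡ xs → y ≢ x → y ∈ˡ ys))
  ∈-remove (x ∷ xs) (here refl) = xs , refl , λ { (here refl) y≢x → ⊥-elim (y≢x refl) ; (there i) _ → i }
  ∈-remove (z ∷ xs) (there x∈xs) with ∈-remove xs x∈xs
  ... | ys , eq , keep =
    z ∷ ys , cong suc eq , λ { (here refl) _ → here refl ; (there i) y≢x → there (keep i y≢x) }

  Unique-length≤ : ∀ {xs ys : List A} → Unique ys → (∀ {y : A} → y ∈ˡ ys → y ∈ˡ xs) →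
                   length ys ≤ length xs
  Unique-length≤ [] _ = z≤n
  Unique-length≤ {xs} (y≢ys ∷ unique) ys⊆xs =
    let zs , eq , keep = ∈-remove xs (ys⊆xs (here refl)) in
    subst (suc _ ≤_) (sym eq)
      (s≤s (Unique-length≤ unique λ i → keep (ys⊆xs (there i)) (≢-sym (All.lookup y≢ys i))))

  length≡1 : (xs : List A) → length xs ≡ 1 → ∃[ p ] xs ≡ p ∷ []
  length≡1 (p ∷ []) refl = p , refl

  length≡3 : (xs : List A) → length xs ≡ 3 → ∃[ a ] ∃[ b ] ∃[ c ] xs ≡ a ∷ b ∷ c ∷ []
  length≡3 (a ∷ b ∷ c ∷ []) refl = a , b , c , refl

  OtherTwo : A → List A → Set
  OtherTwo v xs = ∃[ w₁ ] ∃[ w₂ ] (w₁ ≢ w₂ × w₁ ≢ v × w₂ ≢ v × w₁ ∈ˡ xs × w₂ ∈ˡ xs ×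
                                   (∀ {t} → t ∈ˡ xs → t ≡ v ⊎ t ≡ w₁ ⊎ t ≡ w₂))

  otherTwo : ∀ {v a b c : A} → Unique (a ∷ b ∷ c ∷ []) → v ∈ˡ (a ∷ b ∷ c ∷ []) →
             OtherTwo v (a ∷ b ∷ c ∷ [])
  otherTwo ((a≢b ∷ a≢c ∷ []) ∷ (b≢c ∷ []) ∷ _) (here refl) =
    _ , _ , b≢c , ≢-sym a≢b , ≢-sym a≢c , there (here refl) , there (there (here refl)) ,
    λ { (here p) → inj₁ p ; (there (here p)) → inj₂ (inj₁ p) ; (there (there (here p))) → inj₂ (inj₂ p) }
  otherTwo ((a≢b ∷ a≢c ∷ []) ∷ (b≢c ∷ []) ∷ _) (there (here refl)) =
    _ , _ , a≢c , a≢b , ≢-sym b≢c , here refl , there (there (here refl)) ,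
    λ { (here p) → inj₂ (inj₁ p) ; (there (here p)) → inj₁ p ; (there (there (here p))) → inj₂ (inj₂ p) }
  otherTwo ((a≢b ∷ a≢c ∷ []) ∷ (b≢c ∷ []) ∷ _) (there (there (here refl))) =
    _ , _ , a≢b , a≢c , b≢c , here refl , there (here refl) ,
    λ { (here p) → inj₂ (inj₁ p) ; (there (here p)) → inj₂ (inj₂ p) ; (there (there (here p))) → inj₁ p }

  sum-indicator≡length-filterᵇ : (f : A → Bool) (xs : List A) →
                                sum (map (λ w → if f w then 1 else 0) xs) ≡ length (filterᵇ f xs)
  sum-indicator≡length-filterᵇ f [] = refl
  sum-indicator≡length-filterᵇ f (x ∷ xs) with f x
  ... | true = cong suc (sum-indicator≡length-filterᵇ f xs)
  ... | false = sum-indicator≡length-filterᵇ f xs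

∣p∪q∣≤∣p∣+∣q∣ : ∀ {k} (p q : Subset k) → ∣ p ∪ q ∣ ≤ ∣ p ∣ + ∣ q ∣
∣p∪q∣≤∣p∣+∣q∣ [] [] = z≤n
∣p∪q∣≤∣p∣+∣q∣ (true ∷ p) (true ∷ q) =
  s≤s (≤-trans (∣p∪q∣≤∣p∣+∣q∣ p q) (+-monoʳ-≤ ∣ p ∣ (n≤1+n _)))
∣p∪q∣≤∣p∣+∣q∣ (true ∷ p) (false ∷ q) = s≤s (∣p∪q∣≤∣p∣+∣q∣ p q)
∣p∪q∣≤∣p∣+∣q∣ (false ∷ p) (true ∷ q) =
  subst (suc ∣ p ∪ q ∣ ≤_) (sym (+-suc ∣ p ∣ ∣ q ∣)) (s≤s (∣p∪q∣≤∣p∣+∣q∣ p q))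
∣p∪q∣≤∣p∣+∣q∣ (false ∷ p) (false ∷ q) = ∣p∪q∣≤∣p∣+∣q∣ p q

∃-third : ∀ {k} (S : Subset k) → 3 ≤ ∣ S ∣ → ∀ a b → ∃[ r ] (r ∈ S × r ≢ a × r ≢ b)
∃-third S 3≤∣S∣ a b with any? (λ r → (r ∈? S) ×-dec (¬? (r ≟ a) ×-dec ¬? (r ≟ b)))
... | yes found = found
... | no none = ⊥-elim (<⇒≱ (≤-trans (s≤s (s≤s (s≤s z≤n))) 3≤∣S∣) ∣S∣≤2)
  where
  S⊆ab : S ⊆ ⁅ a ⁆ ∪ ⁅ b ⁆
  S⊆ab {x} x∈S with x ≟ a | x ≟ b
  ... | yes refl | _ = x∈p∪q⁺ (inj₁ (x∈⁅x⁆ x))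
  ... | no _ | yes refl = x∈p∪q⁺ (inj₂ (x∈⁅x⁆ x))
  ... | no x≢a | no x≢b = ⊥-elim (none (x , x∈S , x≢a , x≢b))
  ∣S∣≤2 : ∣ S ∣ ≤ 2
  ∣S∣≤2 = ≤-trans (p⊆q⇒∣p∣≤∣q∣ S⊆ab)
            (≤-trans (∣p∪q∣≤∣p∣+∣q∣ ⁅ a ⁆ ⁅ b ⁆)
                     (≤-reflexive (cong₂ _+_ (∣⁅x⁆∣≡1 a) (∣⁅x⁆∣≡1 b))))

three≤∣p∣ : ∀ {k} {p : Subset k} {a b c} → a ∈ p → b ∈ p → c ∈ p →
            a ≢ b → a ≢ c → b ≢ c → 3 ≤ ∣ p ∣
three≤∣p∣ {p = p} {a} {b} {c} a∈p b∈p c∈p a≢b a≢c b≢c =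
  ≤-trans (s≤s (≤-trans (s≤s (≤-trans (s≤s z≤n) (x∈p⇒∣p-x∣<∣p∣ c∈p-a-b)))
                        (x∈p⇒∣p-x∣<∣p∣ b∈p-a)))
          (x∈p⇒∣p-x∣<∣p∣ a∈p)
  where
  b∈p-a : b ∈ p - a
  b∈p-a = x∈p∧x≢y⇒x∈p-y b∈p (≢-sym a≢b)
  c∈p-a-b : c ∈ p - a - b
  c∈p-a-b = x∈p∧x≢y⇒x∈p-y (x∈p∧x≢y⇒x∈p-y c∈p (≢-sym a≢c)) (≢-sym b≢c)

AtLeastTwo-map : ∀ {k} {P Q : Fin k → Set} → (∀ x → P x → Q x) → AtLeastTwo P → AtLeastTwo Q
AtLeastTwo-map f (a , b , a≢b , pa , pb) = a , b , a≢b , f a pa , f b pb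

module _ {n : ℕ} where

  subsetOf : {P : Fin n → Set} → Decidable P → Subset n
  subsetOf P? = Vec.tabulate (does ∘ P?)

  ∈-subsetOf⁺ : {P : Fin n → Set} (P? : Decidable P) → ∀ {x} → P x → x ∈ subsetOf P?
  ∈-subsetOf⁺ P? {x} px with P? x in eq
  ... | yes _ = lookup⇒[]= x _ (trans (lookup∘tabulate _ x) (cong does eq))
  ... | no ¬px = ⊥-elim (¬px px)

  ∈-subsetOf⁻ : {P : Fin n → Set} (P? : Decidable P) → ∀ {x} → x ∈ subsetOf P? → P x
  ∈-subsetOf⁻ P? {x} x∈ with P? x in eq
  ... | yes px = px
  ... | no _ with trans (sym (cong does eq)) (trans (sym (lookup∘tabulate _ x)) ([]=⇒lookup x∈))
  ...   | ()

  Within : (Fin n → Set) → Rel n → Rel n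
  Within P E a b = E a b × P a × P b

  module _ {E : Rel n} where

    Reach-trans : ∀ {a b c} → Reach E a b → Reach E b c → Reach E a c
    Reach-trans here q = q
    Reach-trans (step e p) q = step e (Reach-trans p q)

    Reach-snoc : ∀ {a b c} → Reach E a b → E b c → Reach E a c
    Reach-snoc p e = Reach-trans p (step e here)

    Reach-reverse : (∀ {a b} → E a b → E b a) → ∀ {a b} → Reach E a b → Reach E b a
    Reach-reverse E-sym here = here
    Reach-reverse E-sym (step e p) = Reach-snoc (Reach-reverse E-sym p) (E-sym e)

    Reach-preserves : (P : Fin n → Set) → (∀ {a b} → P a → E a b → P b) →
                      ∀ {a b} → P a → Reach E a b → P b
    Reach-preserves P step-P pa here = pa
    Reach-preserves P step-P pa (step e r) = Reach-preserves P step-P (step-P pa e) r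

    Reach-within : (P : Fin n → Set) → (∀ {a b} → P a → E a b → P b) →
                   ∀ {a b} → P a → Reach E a b → Reach (Within P E) a b
    Reach-within P step-P pa here = here
    Reach-within P step-P pa (step e r) = step (e , pa , step-P pa e) (Reach-within P step-P (step-P pa e) r)

    Reach-firstStep : ∀ {a b} → Reach E a b → a ≢ b → ∃[ c ] (E a c × Reach E c b)
    Reach-firstStep here a≢a = ⊥-elim (a≢a refl)
    Reach-firstStep (step e r) _ = _ , e , r

    Reach-firstEntry : (P : Fin n → Set) → Decidable P → ∀ {a b} → ¬ P a → Reach E a b →
                       Reach (Within (¬_ ∘ P) E) a b ⊎
                       ∃[ c ] ∃[ d ] (Reach (Within (¬_ ∘ P) E) a c × E c d × P d)
    Reach-firstEntry P P? ¬pa here = inj₁ here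
    Reach-firstEntry P P? ¬pa (step {v = c} e r) with P? c
    ... | yes pc = inj₂ (_ , _ , here , e , pc)
    ... | no ¬pc with Reach-firstEntry P P? ¬pc r
    ...   | inj₁ p = inj₁ (step (e , ¬pa , ¬pc) p)
    ...   | inj₂ (c' , d , p , e' , pd) = inj₂ (c' , d , step (e , ¬pa , ¬pc) p , e' , pd)

  Reach-map : ∀ {E F : Rel n} → (∀ {a b} → E a b → F a b) → ∀ {a b} → Reach E a b → Reach F a b
  Reach-map f here = here
  Reach-map f (step e p) = step (f e) (Reach-map f p)

  Reach-within-end : ∀ {E : Rel n} {P : Fin n → Set} {a b} → Reach (Within P E) a b → P a → P b
  Reach-within-end here pa = pa
  Reach-within-end (step (_ , _ , pb) r) _ = Reach-within-end r pb

  SameEdge? : (a b u v : Fin n) → Dec (SameEdge a b u v)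
  SameEdge? a b u v = ((a ≟ u) ×-dec (b ≟ v)) ⊎-dec ((a ≟ v) ×-dec (b ≟ u))

  Reach-delEdge : ∀ {E : Rel n} u v {a b} → Reach E a b →
     Reach (DelEdge E u v) a b ⊎
     ((Reach (DelEdge E u v) a u ⊎ Reach (DelEdge E u v) a v) ×
      (Reach (DelEdge E u v) u b ⊎ Reach (DelEdge E u v) v b))
  Reach-delEdge u v here = inj₁ here
  Reach-delEdge u v {a} (step {v = c} e r) with SameEdge? a c u v | Reach-delEdge u v r
  ... | no ne | inj₁ p = inj₁ (step (e , ne) p)
  ... | no ne | inj₂ (inj₁ p , q) = inj₂ (inj₁ (step (e , ne) p) , q)
  ... | no ne | inj₂ (inj₂ p , q) = inj₂ (inj₂ (step (e , ne) p) , q)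
  ... | yes (inj₁ (refl , refl)) | inj₁ p = inj₂ (inj₁ here , inj₂ p)
  ... | yes (inj₂ (refl , refl)) | inj₁ p = inj₂ (inj₂ here , inj₁ p)
  ... | yes (inj₁ (refl , refl)) | inj₂ (_ , q) = inj₂ (inj₁ here , q)
  ... | yes (inj₂ (refl , refl)) | inj₂ (_ , q) = inj₂ (inj₂ here , q)

  data Path (E : Rel n) : Fin n → Fin n → List (Fin n) → Set where
    [_] : ∀ a → Path E a a (a ∷ [])
    _∷⟨_,_⟩ : ∀ {a a' b vs} → E a a' → ¬ a ∈ˡ vs → Path E a' b vs → Path E a b (a ∷ vs)

  module _ {E : Rel n} where

    Path-head : ∀ {a b vs} → Path E a b vs → a ∈ˡ vs
    Path-head [ _ ] = here refl
    Path-head (_ ∷⟨ _ , _ ⟩) = here refl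

    Path-last : ∀ {a b vs} → Path E a b vs → b ∈ˡ vs
    Path-last [ _ ] = here refl
    Path-last (_ ∷⟨ _ , p ⟩) = there (Path-last p)

    Path-unique : ∀ {a b vs} → Path E a b vs → Unique vs
    Path-unique [ _ ] = [] ∷ []
    Path-unique (_ ∷⟨ a∉vs , p ⟩) = ¬Any⇒All¬ _ a∉vs ∷ Path-unique p

    Path-length≤ : ∀ {a b vs} → Path E a b vs → length vs ≤ n
    Path-length≤ {vs = vs} p =
      subst (length vs ≤_) (length-tabulate _) (Unique-length≤ (Path-unique p) (λ {y} _ → ∈-allFin y))

    Path-suffix : ∀ {a b vs x} → Path E a b vs → x ∈ˡ vs → ∃[ ws ] Path E x b ws
    Path-suffix [ _ ] (here refl) = _ , [ _ ]
    Path-suffix p@(_ ∷⟨ _ , _ ⟩) (here refl) = _ , p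
    Path-suffix (_ ∷⟨ _ , p ⟩) (there i) = Path-suffix p i

    Reach⇒Path : ∀ {a b} → Reach E a b → ∃[ vs ] Path E a b vs
    Reach⇒Path here = _ , [ _ ]
    Reach⇒Path {a} (step e r) with Reach⇒Path r
    ... | vs , p with anyˡ? (a ≟_) vs
    ...   | yes a∈vs = Path-suffix p a∈vs
    ...   | no a∉vs = _ , e ∷⟨ a∉vs , p ⟩

    Path-within : (Q : Fin n → Set) → ∀ {a b vs} → Path E a b vs → (∀ {x} → x ∈ˡ vs → Q x) →
                  Reach (Within Q E) a b
    Path-within Q [ _ ] _ = here
    Path-within Q (e ∷⟨ _ , p ⟩) q = step (e , q (here refl) , q (there (Path-head p))) (Path-within Q p (q ∘ there))

    Path-from : (Q : Fin n → Set) → ∀ {a b vs t} → Path E a b vs → t ∈ˡ vs → (∀ {x} → x ∈ˡ vs → Q x) →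
                Reach (Within Q E) t b
    Path-from Q [ _ ] (here refl) _ = here
    Path-from Q p@(_ ∷⟨ _ , _ ⟩) (here refl) q = Path-within Q p q
    Path-from Q (_ ∷⟨ _ , p ⟩) (there i) q = Path-from Q p i (q ∘ there)

    Path-to : (Q : Fin n → Set) → ∀ {a b vs t} → Path E a b vs → t ∈ˡ vs → (∀ {x} → x ∈ˡ vs → Q x) →
              Reach (Within Q E) a t
    Path-to Q [ _ ] (here refl) _ = here
    Path-to Q (_ ∷⟨ _ , _ ⟩) (here refl) _ = here
    Path-to Q (e ∷⟨ _ , p ⟩) (there i) q =
      step (e , q (here refl) , q (there (Path-head p))) (Path-to Q p i (q ∘ there))

    Path-avoiding : (Q : Fin n → Set) → (∀ {x y} → E x y → E y x) →
                    ∀ {a b vs t w} → Path E a b vs → t ∈ˡ vs → t ≢ w → (∀ {x} → x ∈ˡ vs → Q x) →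
                    Reach (Within (λ x → Q x × x ≢ w) E) t a ⊎ Reach (Within (λ x → Q x × x ≢ w) E) t b
    Path-avoiding Q E-sym [ _ ] (here refl) _ _ = inj₁ here
    Path-avoiding Q E-sym (_ ∷⟨ _ , _ ⟩) (here refl) _ _ = inj₁ here
    Path-avoiding Q E-sym {t = t} {w} (_∷⟨_,_⟩ {a} e a∉vs p) (there i) t≢w q
      with Path-avoiding Q E-sym p i t≢w (q ∘ there)
    ... | inj₂ r = inj₂ r
    ... | inj₁ r with a ≟ w
    ...   | yes refl = inj₂ (Reach-trans r (Path-within _ p λ j → q (there j) , λ { refl → a∉vs j }))
    ...   | no a≢w = inj₁ (Reach-snoc r (E-sym e , Reach-within-end r (q (there i) , t≢w) , q (here refl) , a≢w))

  Path-allWithin : ∀ {Q : Fin n → Set} {F : Rel n} {a b vs} → Path (Within Q F) a b vs → Q a →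
                   ∀ {x} → x ∈ˡ vs → Q x
  Path-allWithin [ _ ] qa (here refl) = qa
  Path-allWithin (_ ∷⟨ _ , _ ⟩) qa (here refl) = qa
  Path-allWithin ((_ , _ , qa') ∷⟨ _ , p ⟩) _ (there i) = Path-allWithin p qa' i

  ReachIn : Rel n → ℕ → Rel n
  ReachIn E zero a b = a ≡ b
  ReachIn E (suc k) a b = a ≡ b ⊎ ∃[ c ] (E a c × ReachIn E k c b)

  module _ {E : Rel n} where

    ReachIn? : (∀ a b → Dec (E a b)) → ∀ k a b → Dec (ReachIn E k a b)
    ReachIn? E? zero a b = a ≟ b
    ReachIn? E? (suc k) a b = (a ≟ b) ⊎-dec any? (λ c → E? a c ×-dec ReachIn? E? k c b)

    ReachIn⇒Reach : ∀ {k a b} → ReachIn E k a b → Reach E a b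
    ReachIn⇒Reach {zero} refl = here
    ReachIn⇒Reach {suc k} (inj₁ refl) = here
    ReachIn⇒Reach {suc k} (inj₂ (c , e , r)) = step e (ReachIn⇒Reach r)

    ReachIn-suc : ∀ {k a b} → ReachIn E k a b → ReachIn E (suc k) a b
    ReachIn-suc {zero} eq = inj₁ eq
    ReachIn-suc {suc k} (inj₁ eq) = inj₁ eq
    ReachIn-suc {suc k} (inj₂ (c , e , r)) = inj₂ (c , e , ReachIn-suc r)

    ReachIn-+ : ∀ {k a b} d → ReachIn E k a b → ReachIn E (d + k) a b
    ReachIn-+ zero r = r
    ReachIn-+ (suc d) r = ReachIn-suc (ReachIn-+ d r)

    Path⇒ReachIn : ∀ {a b vs} → Path E a b vs → ReachIn E (length vs) a b
    Path⇒ReachIn [ _ ] = inj₁ refl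
    Path⇒ReachIn (e ∷⟨ _ , p ⟩) = inj₂ (_ , e , Path⇒ReachIn p)

    -- Simple paths have at most n vertices, so reachability is reachability in n steps.
    Reach? : (∀ a b → Dec (E a b)) → ∀ a b → Dec (Reach E a b)
    Reach? E? a b with ReachIn? E? n a b
    ... | yes r = yes (ReachIn⇒Reach r)
    ... | no ¬r = no λ r → let (vs , p) = Reach⇒Path r in
        ¬r (subst (λ k → ReachIn E k a b) (m∸n+n≡m (Path-length≤ p))
                  (ReachIn-+ (n ∸ length vs) (Path⇒ReachIn p)))

module _ {m : ℕ} (N : Network m) where
  open Network N renaming (sym to adj-sym)

  Adj-sym : ∀ {a b} → Adj a b → Adj b a
  Adj-sym {a} {b} = subst T (adj-sym a b)

  Adj? : ∀ a b → Dec (Adj a b)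
  Adj? a b = T? (adj a b)

  Adj⇒≢ : ∀ {a b} → Adj a b → a ≢ b
  Adj⇒≢ {a} e refl = subst T (irrefl a) e

  IsLeaf? : ∀ t → Dec (IsLeaf t)
  IsLeaf? t = any? (λ x → leaf x ≟ t)

  Adj∖ : Fin n → Fin n → Rel n
  Adj∖ = DelEdge Adj

  OnSide : Fin n → Fin n → Fin n → Set
  OnSide u v = Reach (Adj∖ u v) u

  Adj∖-sym : ∀ {u v a b} → Adj∖ u v a b → Adj∖ u v b a
  Adj∖-sym (e , ne) = Adj-sym e , λ { (inj₁ (p , q)) → ne (inj₂ (q , p)) ; (inj₂ (p , q)) → ne (inj₁ (q , p)) }

  Adj∖-flip : ∀ {u v a b} → Adj∖ u v a b → Adj∖ v u a b
  Adj∖-flip (e , ne) = e , λ { (inj₁ pq) → ne (inj₂ pq) ; (inj₂ pq) → ne (inj₁ pq) }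

  Adj∖? : ∀ u v a b → Dec (Adj∖ u v a b)
  Adj∖? u v a b = Adj? a b ×-dec ¬? (SameEdge? a b u v)

  Adj∖∖⇒Adj∖ : ∀ {p q u v a b} → DelEdge (Adj∖ p q) u v a b → Adj∖ u v a b
  Adj∖∖⇒Adj∖ ((e , _) , ne) = e , ne

  OnSide? : ∀ u v t → Dec (OnSide u v t)
  OnSide? u v = Reach? (Adj∖? u v) u

  Side? : ∀ u v x → Dec (Side u v x)
  Side? u v x = OnSide? u v (leaf x)

  CutEdge-flip : ∀ {u v} → CutEdge u v → CutEdge v u
  CutEdge-flip (e , ¬uv) = Adj-sym e , λ r → ¬uv (Reach-reverse Adj∖-sym (Reach-map Adj∖-flip r))

  OnSide-complement : ∀ {u v t} → ¬ OnSide u v t → OnSide v u t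
  OnSide-complement {u} {v} {t} ¬ut with Reach-delEdge u v (connected v t)
  ... | inj₁ r = Reach-map Adj∖-flip r
  ... | inj₂ (_ , inj₁ r) = ⊥-elim (¬ut r)
  ... | inj₂ (_ , inj₂ r) = Reach-map Adj∖-flip r

  -- A walk from p avoiding u and the edge pq cannot cross the cut-edge uv.
  OnSide-nested : ∀ {u v p q t} → CutEdge u v → OnSide u v p → ¬ OnSide p q u → OnSide p q t → OnSide u v t
  OnSide-nested {u} {v} (_ , ¬uv) up ¬pu pt with Reach-delEdge u v pt
  ... | inj₁ r = Reach-trans up (Reach-map Adj∖∖⇒Adj∖ r)
  ... | inj₂ (inj₁ r , _) = ⊥-elim (¬pu (Reach-map proj₁ r))
  ... | inj₂ (inj₂ r , _) = ⊥-elim (¬uv (Reach-trans up (Reach-map Adj∖∖⇒Adj∖ r)))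

  OnSide-reaches : ∀ {u v u' v' t} → CutEdge u v → ¬ OnSide u v u' → OnSide u' v' t → OnSide u v t →
                   OnSide u' v' u
  OnSide-reaches {u} {v} {u'} {v'} (uv , ¬uv) ¬uu' u't ut with Reach-delEdge u v u't
  ... | inj₁ r = ⊥-elim (¬uu' (Reach-trans ut (Reach-reverse Adj∖-sym (Reach-map Adj∖∖⇒Adj∖ r))))
  ... | inj₂ (inj₁ r , _) = Reach-map proj₁ r
  ... | inj₂ (inj₂ r , _) with SameEdge? v u u' v'
  ...   | no ne = Reach-snoc (Reach-map proj₁ r) (Adj-sym uv , ne)
  ...   | yes (inj₂ (_ , refl)) = ⊥-elim (¬uu' here)
  ...   | yes (inj₁ (refl , refl)) = ⊥-elim (¬uv (Reach-trans ut (Reach-reverse Adj∖-sym (Reach-map Adj∖-flip u't))))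

  neighbours : Fin n → List (Fin n)
  neighbours v = filterᵇ (adj v) (allFin n)

  ∈-neighbours⁺ : ∀ {v w} → Adj v w → w ∈ˡ neighbours v
  ∈-neighbours⁺ {v} {w} = ∈-filter⁺ (T? ∘ adj v) (∈-allFin w)

  ∈-neighbours⁻ : ∀ {v w} → w ∈ˡ neighbours v → Adj v w
  ∈-neighbours⁻ {v} = proj₂ ∘ ∈-filter⁻ (T? ∘ adj v) {xs = allFin n}

  neighbours-unique : ∀ v → Unique (neighbours v)
  neighbours-unique v = filter⁺ (T? ∘ adj v) (allFin⁺ n)

  length-neighbours : ∀ v → length (neighbours v) ≡ degree v
  length-neighbours v = sym (sum-indicator≡length-filterᵇ (adj v) (allFin n))

  degree≤3 : ∀ v → degree v ≤ 3
  degree≤3 v with IsLeaf? v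
  ... | yes (x , refl) = ≤-trans (≤-reflexive (leaf-deg x)) (s≤s z≤n)
  ... | no ¬leaf = ≤-reflexive (other-deg v (λ x eq → ¬leaf (x , eq)))

  ¬fourNeighbours : ∀ {v a b c d} → Adj v a → Adj v b → Adj v c → Adj v d →
                    a ≢ b → a ≢ c → a ≢ d → b ≢ c → b ≢ d → c ≢ d → ⊥
  ¬fourNeighbours {v} ea eb ec ed a≢b a≢c a≢d b≢c b≢d c≢d = 4≰3 (≤-trans four≤ (degree≤3 v))
    where
    four≤ : 4 ≤ degree v
    four≤ = subst (4 ≤_) (length-neighbours v)
      (Unique-length≤ ((a≢b ∷ a≢c ∷ a≢d ∷ []) ∷ (b≢c ∷ b≢d ∷ []) ∷ (c≢d ∷ []) ∷ [] ∷ [])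
        λ { (here refl) → ∈-neighbours⁺ ea
          ; (there (here refl)) → ∈-neighbours⁺ eb
          ; (there (there (here refl))) → ∈-neighbours⁺ ec
          ; (there (there (there (here refl)))) → ∈-neighbours⁺ ed })
    4≰3 : ¬ 4 ≤ 3
    4≰3 (s≤s (s≤s (s≤s ())))

  leaf-neighbours : ∀ x → ∃[ p ] neighbours (leaf x) ≡ p ∷ []
  leaf-neighbours x = length≡1 _ (trans (length-neighbours (leaf x)) (leaf-deg x))

  leaf-neighbour : ∀ x → ∃[ p ] Adj (leaf x) p
  leaf-neighbour x = let p , eq = leaf-neighbours x in
    p , ∈-neighbours⁻ (subst (p ∈ˡ_) (sym eq) (here refl))

  leaf-adj-unique : ∀ {x a b} → Adj (leaf x) a → Adj (leaf x) b → a ≡ b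
  leaf-adj-unique {x} ea eb with leaf-neighbours x
  ... | p , eq with subst (_ ∈ˡ_) eq (∈-neighbours⁺ ea) | subst (_ ∈ˡ_) eq (∈-neighbours⁺ eb)
  ...   | here refl | here refl = refl

  record OtherNeighbours (u v : Fin n) : Set where
    field
      w₁ w₂ : Fin n
      w₁≢w₂ : w₁ ≢ w₂
      w₁≢v : w₁ ≢ v
      w₂≢v : w₂ ≢ v
      uw₁ : Adj u w₁
      uw₂ : Adj u w₂
      cover : ∀ {t} → Adj u t → t ≡ v ⊎ t ≡ w₁ ⊎ t ≡ w₂

  otherNeighbours : ∀ {u v} → ¬ IsLeaf u → Adj u v → OtherNeighbours u v
  otherNeighbours {u} ¬leaf uv
    with length≡3 (neighbours u) (trans (length-neighbours u) (other-deg u λ x eq → ¬leaf (x , eq)))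
  ... | a , b , c , eq
    with otherTwo (subst Unique eq (neighbours-unique u)) (subst (_ ∈ˡ_) eq (∈-neighbours⁺ uv))
  ...   | w₁ , w₂ , w₁≢w₂ , w₁≢v , w₂≢v , w₁∈ , w₂∈ , cover = record
          { w₁ = w₁ ; w₂ = w₂ ; w₁≢w₂ = w₁≢w₂ ; w₁≢v = w₁≢v ; w₂≢v = w₂≢v
          ; uw₁ = ∈-neighbours⁻ (subst (_ ∈ˡ_) (sym eq) w₁∈)
          ; uw₂ = ∈-neighbours⁻ (subst (_ ∈ˡ_) (sym eq) w₂∈)
          ; cover = λ ut → cover (subst (_ ∈ˡ_) eq (∈-neighbours⁺ ut)) }

  -- Two adjacent leaves would form a whole component.
  leaf-adj-nonLeaf : ∀ {x p z} → ¬ IsLeaf z → Adj (leaf x) p → ¬ IsLeaf p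
  leaf-adj-nonLeaf {x} {z = z} ¬lz xp (y , refl) =
    ¬lz (pair-component (Reach-preserves Pair Pair-step (inj₁ refl) (connected (leaf x) z)))
    where
    Pair : Fin n → Set
    Pair t = t ≡ leaf x ⊎ t ≡ leaf y
    Pair-step : ∀ {a b} → Pair a → Adj a b → Pair b
    Pair-step (inj₁ refl) e = inj₂ (leaf-adj-unique e xp)
    Pair-step (inj₂ refl) e = inj₁ (leaf-adj-unique e (Adj-sym xp))
    pair-component : Pair z → IsLeaf z
    pair-component (inj₁ refl) = x , refl
    pair-component (inj₂ refl) = y , refl

  -- A leaf can only be entered and left through its single neighbour.
  Reach-avoidLeaves : ∀ {E : Rel n} → (∀ {a b} → E a b → Adj a b) → ∀ {a b} → ¬ IsLeaf a → ¬ IsLeaf b →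
                      Reach E a b → Reach (Within (¬_ ∘ IsLeaf) E) a b
  Reach-avoidLeaves f ¬la ¬lb here = here
  Reach-avoidLeaves f ¬la ¬lb (step {v = c} e r) with IsLeaf? c
  ... | no ¬lc = step (e , ¬la , ¬lc) (Reach-avoidLeaves f ¬lc ¬lb r)
  ... | yes (x , refl) with r
  ...   | here = ⊥-elim (¬lb (x , refl))
  ...   | step e₂ r₂ with leaf-adj-unique (Adj-sym (f e)) (f e₂)
  ...     | refl = Reach-avoidLeaves f ¬la ¬lb r₂

  leafEdge-stuck : ∀ {x p t} → Adj (leaf x) p → OnSide (leaf x) p t → t ≡ leaf x
  leafEdge-stuck e here = refl
  leafEdge-stuck e (step (e' , ne) _) = ⊥-elim (ne (inj₁ (refl , leaf-adj-unique e' e)))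

  leafEdge-cut : ∀ {x p} → Adj (leaf x) p → CutEdge (leaf x) p
  leafEdge-cut e = e , λ r → Adj⇒≢ e (sym (leafEdge-stuck e r))

  Side-leafEdge : ∀ {x p y} → Adj (leaf x) p → Side (leaf x) p y → y ≡ x
  Side-leafEdge e s = leaf-inj _ _ (leafEdge-stuck e s)

  Side-leafEdge-other : ∀ {x p y} → Adj (leaf x) p → y ≢ x → Side p (leaf x) y
  Side-leafEdge-other e y≢x = OnSide-complement (y≢x ∘ Side-leafEdge e)

  -- By the standing assumption, a side with only one leaf x is the split of the edge at x.
  nonLeaf-twoSides : ∀ {u v} → CutEdge u v → ¬ IsLeaf u → AtLeastTwo (Side u v)
  nonLeaf-twoSides {u} {v} ce ¬leaf with cut-nonempty u v ce
  ... | x , sx with any? (λ y → ¬? (y ≟ x) ×-dec Side? u v y)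
  ...   | yes (y , y≢x , sy) = x , y , ≢-sym y≢x , sx , sy
  ...   | no none = ⊥-elim (¬leaf (x , sym (proj₁ (cut-distinct u v (leaf x) p ce (leafEdge-cut xp) sameSplit))))
    where
    p : Fin n
    p = proj₁ (leaf-neighbour x)
    xp : Adj (leaf x) p
    xp = proj₂ (leaf-neighbour x)
    only : ∀ {y} → Side u v y → y ≡ x
    only {y} s with y ≟ x
    ... | yes eq = eq
    ... | no y≢x = ⊥-elim (none (y , y≢x , s))
    sameSplit : ∀ y → (Side u v y → Side (leaf x) p y) × (Side (leaf x) p y → Side u v y)
    sameSplit y = (λ s → subst (Side (leaf x) p) (sym (only s)) here) ,
                  (λ s → subst (Side u v) (sym (Side-leafEdge xp s)) sx)

  Induced-sym : ∀ {S a b} → Induced S a b → Induced S b a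
  Induced-sym (e , aS , bS) = Adj-sym e , bS , aS

  Induced∖ : Subset n → Fin n → Rel n
  Induced∖ S w a b = Induced S a b × Minus S w a × Minus S w b

  Induced∖-sym : ∀ {S w a b} → Induced∖ S w a b → Induced∖ S w b a
  Induced∖-sym (i , a-w , b-w) = Induced-sym i , b-w , a-w

  Induced∖-edge : ∀ {S w a b} → Adj a b → a ∈ S → b ∈ S → a ≢ w → b ≢ w → Induced∖ S w a b
  Induced∖-edge e aS bS a≢w b≢w = (e , aS , bS) , (aS , a≢w) , (bS , b≢w)

  -- The only neighbour of a leaf would separate it from the rest of the set.
  twoConnected-¬leaf : ∀ {S z} → TwoConnected S → z ∈ S → ¬ IsLeaf z
  twoConnected-¬leaf {S} (3≤∣S∣ , conn , conn∖) zS (x , refl) =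
    let p , xp = leaf-neighbour x
        r , rS , r≢x , r≢p = ∃-third S 3≤∣S∣ (leaf x) p
        q , (xq , _ , qS) , _ = Reach-firstStep (conn (leaf x) r zS rS) (≢-sym r≢x)
        pS = subst (_∈ S) (leaf-adj-unique xq xp) qS
        q' , ((xq' , _) , _ , (_ , q'≢p)) , _ =
          Reach-firstStep (conn∖ p pS (leaf x) r (zS , Adj⇒≢ xp) (rS , r≢p)) (≢-sym r≢x)
    in q'≢p (leaf-adj-unique xq' xp)

  -- A third vertex r of S gives the detour a → r → b, avoiding b and then a.
  twoConnected-¬CutEdge : ∀ {S a b} → TwoConnected S → a ∈ S → b ∈ S → ¬ CutEdge a b
  twoConnected-¬CutEdge {S} {a} {b} (3≤∣S∣ , _ , conn∖) aS bS (ab , ¬detour) =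
    let r , rS , r≢a , r≢b = ∃-third S 3≤∣S∣ a b in
    ¬detour (Reach-trans (Reach-map avoid-b (conn∖ b bS a r (aS , Adj⇒≢ ab) (rS , r≢b)))
                         (Reach-map avoid-a (conn∖ a aS r b (rS , r≢a) (bS , Adj⇒≢ (Adj-sym ab)))))
    where
    avoid-b : ∀ {x y} → Induced∖ S b x y → Adj∖ a b x y
    avoid-b ((e , _) , (_ , x≢b) , (_ , y≢b)) =
      e , λ { (inj₁ (_ , y≡b)) → y≢b y≡b ; (inj₂ (x≡b , _)) → x≢b x≡b }
    avoid-a : ∀ {x y} → Induced∖ S a x y → Adj∖ a b x y
    avoid-a ((e , _) , (_ , x≢a) , (_ , y≢a)) =
      e , λ { (inj₁ (x≡a , _)) → x≢a x≡a ; (inj₂ (_ , y≡a)) → y≢a y≡a }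

  twoConnected-twoNeighbours : ∀ {S z} → TwoConnected S → z ∈ S →
                               ∃[ s₁ ] ∃[ s₂ ] (s₁ ≢ s₂ × s₁ ∈ S × s₂ ∈ S × Adj z s₁ × Adj z s₂)
  twoConnected-twoNeighbours {S} {z} (3≤∣S∣ , conn , conn∖) zS =
    let r₁ , r₁S , r₁≢z , _ = ∃-third S 3≤∣S∣ z z
        s₁ , (zs₁ , _ , s₁S) , _ = Reach-firstStep (conn z r₁ zS r₁S) (≢-sym r₁≢z)
        r₂ , r₂S , r₂≢z , r₂≢s₁ = ∃-third S 3≤∣S∣ z s₁
        s₂ , ((zs₂ , _ , s₂S) , _ , (_ , s₂≢s₁)) , _ =
          Reach-firstStep (conn∖ s₁ s₁S z r₂ (zS , Adj⇒≢ zs₁) (r₂S , r₂≢s₁)) (≢-sym r₂≢z)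
    in s₁ , s₂ , ≢-sym s₂≢s₁ , s₁S , s₂S , zs₁ , zs₂

  -- Adding to a 2-connected S an ear: a path outside S between neighbours of two distinct vertices of S.
  module Ear {S : Subset n} (tc : TwoConnected S) {y c z d : Fin n} {vs : List (Fin n)}
             (ear : Path (Within (_∉ S) Adj) y c vs) (y∉S : y ∉ S)
             (zS : z ∈ S) (dS : d ∈ S) (z≢d : z ≢ d) (zy : Adj z y) (cd : Adj c d) where

    private
      conn : Connected (_∈ S) (Induced S)
      conn = proj₁ (proj₂ tc)
      conn∖ : ∀ w → w ∈ S → Connected (Minus S w) (Induced∖ S w)
      conn∖ = proj₂ (proj₂ tc)

    S∪ear? : Decidable (λ t → t ∈ S ⊎ t ∈ˡ vs)
    S∪ear? t = (t ∈? S) ⊎-dec anyˡ? (t ≟_) vs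

    S∪ear : Subset n
    S∪ear = subsetOf S∪ear?

    S⊆S∪ear : S ⊆ S∪ear
    S⊆S∪ear tS = ∈-subsetOf⁺ S∪ear? (inj₁ tS)

    ear⊆S∪ear : ∀ {t} → t ∈ˡ vs → t ∈ S∪ear
    ear⊆S∪ear i = ∈-subsetOf⁺ S∪ear? (inj₂ i)

    ear-outside : ∀ {t} → t ∈ˡ vs → t ∉ S
    ear-outside = Path-allWithin ear y∉S

    Within-sym : ∀ {a b} → Within (_∉ S) Adj a b → Within (_∉ S) Adj b a
    Within-sym (e , a∉S , b∉S) = Adj-sym e , b∉S , a∉S

    lift-S : ∀ {w a b} → w ∉ S → Induced S a b → Induced∖ S∪ear w a b
    lift-S w∉S (e , aS , bS) =
      Induced∖-edge e (S⊆S∪ear aS) (S⊆S∪ear bS) (λ { refl → w∉S aS }) (λ { refl → w∉S bS })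

    lift-S∖ : ∀ {w a b} → Induced∖ S w a b → Induced∖ S∪ear w a b
    lift-S∖ ((e , aS , bS) , (_ , a≢w) , (_ , b≢w)) = Induced∖-edge e (S⊆S∪ear aS) (S⊆S∪ear bS) a≢w b≢w

    lift-ear : ∀ {w a b} → Within (λ x → x ∈ˡ vs × x ≢ w) (Within (_∉ S) Adj) a b → Induced∖ S∪ear w a b
    lift-ear ((e , _) , (ia , a≢w) , (ib , b≢w)) = Induced∖-edge e (ear⊆S∪ear ia) (ear⊆S∪ear ib) a≢w b≢w

    via-hub : ∀ {P : Fin n → Set} {E : Rel n} → (∀ {a b} → E a b → E b a) → ∀ h →
              (∀ t → P t → Reach E t h) → Connected P E
    via-hub E-sym h to-h a b pa pb = Reach-trans (to-h a pa) (Reach-reverse E-sym (to-h b pb))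

    inc-S : ∀ {a b} → Induced S a b → Induced S∪ear a b
    inc-S (e , aS , bS) = e , S⊆S∪ear aS , S⊆S∪ear bS

    inc-ear : ∀ {a b} → Within (_∈ˡ vs) (Within (_∉ S) Adj) a b → Induced S∪ear a b
    inc-ear ((e , _) , ia , ib) = e , ear⊆S∪ear ia , ear⊆S∪ear ib

    to-z : ∀ t → t ∈ S∪ear → Reach (Induced S∪ear) t z
    to-z t tS' with ∈-subsetOf⁻ S∪ear? tS'
    ... | inj₁ tS = Reach-map inc-S (conn t z tS zS)
    ... | inj₂ t∈ear = Reach-trans (Reach-map inc-ear (Path-from (_∈ˡ vs) ear t∈ear (λ i → i)))
                         (step (cd , ear⊆S∪ear (Path-last ear) , S⊆S∪ear dS) (Reach-map inc-S (conn d z dS zS)))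

    -- Removing an ear vertex w: the rest of the ear hangs on at y or at c, and S stays connected.
    conn∖-ear : ∀ w → w ∉ S → ∀ t → Minus S∪ear w t → Reach (Induced∖ S∪ear w) t z
    conn∖-ear w w∉S t (tS' , t≢w) with ∈-subsetOf⁻ S∪ear? tS'
    ... | inj₁ tS = Reach-map (lift-S w∉S) (conn t z tS zS)
    ... | inj₂ t∈ear with Path-avoiding (_∈ˡ vs) Within-sym ear t∈ear t≢w (λ i → i)
    ...   | inj₁ t→y = Reach-snoc (Reach-map lift-ear t→y)
              (Induced∖-edge (Adj-sym zy) (ear⊆S∪ear (Path-head ear)) (S⊆S∪ear zS)
                 (proj₂ (Reach-within-end t→y (t∈ear , t≢w))) (λ { refl → w∉S zS }))
    ...   | inj₂ t→c = Reach-trans (Reach-snoc (Reach-map lift-ear t→c)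
              (Induced∖-edge cd (ear⊆S∪ear (Path-last ear)) (S⊆S∪ear dS)
                 (proj₂ (Reach-within-end t→c (t∈ear , t≢w))) (λ { refl → w∉S dS })))
              (Reach-map (lift-S w∉S) (conn d z dS zS))

    -- Removing a vertex w of S: the ear still meets S at one of z, d other than w.
    conn∖-S : ∀ w → w ∈ S → ∃[ h ] (∀ t → Minus S∪ear w t → Reach (Induced∖ S∪ear w) t h)
    conn∖-S w wS with z ≟ w
    ... | yes refl = d , to-d
      where
      to-d : ∀ t → Minus S∪ear z t → Reach (Induced∖ S∪ear z) t d
      to-d t (tS' , t≢z) with ∈-subsetOf⁻ S∪ear? tS'
      ... | inj₁ tS = Reach-map lift-S∖ (conn∖ z zS t d (tS , t≢z) (dS , ≢-sym z≢d))
      ... | inj₂ t∈ear = Reach-snoc (Reach-map lift-ear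
              (Path-from (λ x → x ∈ˡ vs × x ≢ z) ear t∈ear λ i → i , λ { refl → ear-outside i zS }))
              (Induced∖-edge cd (ear⊆S∪ear (Path-last ear)) (S⊆S∪ear dS)
                 (λ { refl → ear-outside (Path-last ear) zS }) (≢-sym z≢d))
    ... | no z≢w = z , to-z'
      where
      to-z' : ∀ t → Minus S∪ear w t → Reach (Induced∖ S∪ear w) t z
      to-z' t (tS' , t≢w) with ∈-subsetOf⁻ S∪ear? tS'
      ... | inj₁ tS = Reach-map lift-S∖ (conn∖ w wS t z (tS , t≢w) (zS , z≢w))
      ... | inj₂ t∈ear = Reach-snoc (Reach-reverse Induced∖-sym (Reach-map lift-ear
              (Path-to (λ x → x ∈ˡ vs × x ≢ w) ear t∈ear λ i → i , λ { refl → ear-outside i wS })))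
              (Induced∖-edge (Adj-sym zy) (ear⊆S∪ear (Path-head ear)) (S⊆S∪ear zS)
                 (λ { refl → y∉S wS }) z≢w)

    twoConnected-S∪ear : TwoConnected S∪ear
    twoConnected-S∪ear =
      ≤-trans (proj₁ tc) (p⊆q⇒∣p∣≤∣q∣ S⊆S∪ear) ,
      via-hub Induced-sym z to-z ,
      λ w wS' → case w ∈? S of λ
        { (yes wS) → let h , to-h = conn∖-S w wS in via-hub Induced∖-sym h to-h
        ; (no w∉S) → via-hub Induced∖-sym z (conn∖-ear w w∉S) }

  -- A walk back from y avoiding zy re-enters S: at z it gives z a fourth neighbour, elsewhere it closes an ear.
  blob-leavingEdge-cut : ∀ {S z y} → Blob S → z ∈ S → y ∉ S → Adj z y → CutEdge z y
  blob-leavingEdge-cut {S} {z} {y} (tc , maximal) zS y∉S zy =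
    zy , λ r → noReturn (Reach-firstEntry (_∈ S) (_∈? S) y∉S (Reach-reverse Adj∖-sym r))
    where
    Outside : Rel n
    Outside = Within (_∉ S) (Adj∖ z y)
    noReturn : Reach Outside y z ⊎ ∃[ c ] ∃[ d ] (Reach Outside y c × Adj∖ z y c d × d ∈ S) → ⊥
    noReturn (inj₁ r) = Reach-within-end r y∉S zS
    noReturn (inj₂ (c , d , r , (cd , ne) , dS)) with d ≟ z
    ... | yes refl =
      let s₁ , s₂ , s₁≢s₂ , s₁S , s₂S , zs₁ , zs₂ = twoConnected-twoNeighbours tc zS
          c∉S = Reach-within-end r y∉S
      in ¬fourNeighbours zy (Adj-sym cd) zs₁ zs₂ (λ { refl → ne (inj₂ (refl , refl)) })
           (λ { refl → y∉S s₁S }) (λ { refl → y∉S s₂S })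
           (λ { refl → c∉S s₁S }) (λ { refl → c∉S s₂S }) s₁≢s₂
    ... | no d≢z =
      let _ , ear = Reach⇒Path (Reach-map (λ { ((e , _) , a∉S , b∉S) → e , a∉S , b∉S }) r)
          open Ear tc ear y∉S zS dS (≢-sym d≢z) zy cd
      in y∉S (maximal S∪ear S⊆S∪ear twoConnected-S∪ear (ear⊆S∪ear (Path-head ear)))

  Side-disjoint : ∀ {u v x} → CutEdge u v → Side v u x → ¬ Side u v x
  Side-disjoint (_ , ¬uv) vx ux = ¬uv (Reach-trans ux (Reach-reverse Adj∖-sym (Reach-map Adj∖-flip vx)))

  leafSide-¬atLeastTwo : ∀ {x p} → Adj (leaf x) p → ¬ AtLeastTwo (Side (leaf x) p)
  leafSide-¬atLeastTwo xp (a , b , a≢b , sa , sb) = a≢b (trans (Side-leafEdge xp sa) (sym (Side-leafEdge xp sb)))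

  module PendantBlobSide {S : Subset n} (blob : Blob S) {u v : Fin n} (uS : u ∈ S) (v∉S : v ∉ S)
           (ce : CutEdge u v) (v-nonLeaf : ¬ IsLeaf v)
           (only : ∀ u' v' → u' ∈ S → v' ∉ S → NonTrivCut u' v' → u' ≡ u × v' ≡ v) where

    private
      tc : TwoConnected S
      tc = proj₁ blob

    AtBlob : Fin n → Set
    AtBlob t = t ∈ S ⊎ (IsLeaf t × ∃[ p ] (Adj t p × p ∈ S))

    -- Every edge leaving S other than uv is a cut-edge to a leaf.
    AtBlob-step : ∀ {a b} → AtBlob a → Adj∖ u v a b → AtBlob b
    AtBlob-step {a} {b} (inj₁ aS) (ab , ne) with b ∈? S
    ... | yes bS = inj₁ bS
    ... | no b∉S with IsLeaf? b
    ...   | yes b-leaf = inj₂ (b-leaf , a , Adj-sym ab , aS)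
    ...   | no b-nonLeaf =
            ⊥-elim (ne (inj₁ (only a b aS b∉S
              (blob-leavingEdge-cut blob aS b∉S ab , twoConnected-¬leaf tc aS , b-nonLeaf))))
    AtBlob-step (inj₂ ((x , refl) , p , xp , pS)) (xb , _) = inj₁ (subst (_∈ S) (leaf-adj-unique xp xb) pS)

    OnSide⇒AtBlob : ∀ {t} → OnSide u v t → AtBlob t
    OnSide⇒AtBlob = Reach-preserves AtBlob AtBlob-step (inj₁ uS)

    ∈⇒OnSide : ∀ {t} → t ∈ S → OnSide u v t
    ∈⇒OnSide tS = Reach-map avoid-uv (proj₁ (proj₂ tc) u _ uS tS)
      where
      avoid-uv : ∀ {a b} → Induced S a b → Adj∖ u v a b
      avoid-uv (e , aS , bS) = e , λ { (inj₁ (_ , refl)) → v∉S bS ; (inj₂ (refl , _)) → v∉S aS }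

    Side⇒ContainedIn : ∀ {x} → Side u v x → ContainedIn x S
    Side⇒ContainedIn {x} s with OnSide⇒AtBlob s
    ... | inj₁ xS = ⊥-elim (twoConnected-¬leaf tc xS (x , refl))
    ... | inj₂ (_ , p , xp , pS) = p , xp , pS

    ContainedIn⇒Side : ∀ {x} → ContainedIn x S → Side u v x
    ContainedIn⇒Side {x} (w , xw , wS) =
      Reach-snoc (∈⇒OnSide wS)
        (Adj-sym xw , λ { (inj₁ (_ , refl)) → v-nonLeaf (x , refl) ; (inj₂ (refl , _)) → v∉S wS })

    atLeastTwo-contained : AtLeastTwo (λ x → ContainedIn x S)
    atLeastTwo-contained =
      let a , b , a≢b , sa , sb = nonLeaf-twoSides ce (twoConnected-¬leaf tc uS)
      in a , b , a≢b , Side⇒ContainedIn sa , Side⇒ContainedIn sb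

    -- A blob T sharing a leaf with S lies on u's side of uv, hence inside S, hence equals S.
    contained-disjoint : ∀ {T y} → Blob T → T ≢ S → ContainedIn y T → ¬ ContainedIn y S
    contained-disjoint {T} (tcT , maximalT) T≢S (w₁ , yw₁ , w₁T) (w₂ , yw₂ , w₂S) =
      T≢S (⊆-antisym T⊆S S⊆T)
      where
      w₂T : w₂ ∈ T
      w₂T = subst (_∈ T) (leaf-adj-unique yw₁ yw₂) w₁T
      avoid-uv : ∀ {a b} → Induced T a b → Adj∖ u v a b
      avoid-uv (e , aT , bT) = e , λ
        { (inj₁ (refl , refl)) → twoConnected-¬CutEdge tcT aT bT ce
        ; (inj₂ (refl , refl)) → twoConnected-¬CutEdge tcT bT aT ce }
      T⊆S : T ⊆ S
      T⊆S {t} tT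
        with OnSide⇒AtBlob (Reach-trans (∈⇒OnSide w₂S) (Reach-map avoid-uv (proj₁ (proj₂ tcT) w₂ t w₂T tT)))
      ... | inj₁ tS = tS
      ... | inj₂ (t-leaf , _) = ⊥-elim (twoConnected-¬leaf tcT tT t-leaf)
      S⊆T : S ⊆ T
      S⊆T = maximalT S T⊆S tc

    -- If u' is off the u-side, the u'-side swallows the u-side.  Otherwise u' ∈ S, and u'v' is either uv
    -- itself or an edge to a leaf, whose other side contains a leaf beyond v.
    Side-minimal : ∀ {u' v'} → CutEdge u' v' → AtLeastTwo (Side u' v') →
                   (∀ x → Side u' v' x → Side u v x) → ∀ z → Side u v z → Side u' v' z
    Side-minimal {u'} {v'} ce' two' sub z uz with OnSide? u v u'
    ... | no ¬uu' = let x , _ , _ , u'x , _ = two' in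
                    OnSide-nested ce' (OnSide-reaches ce ¬uu' u'x (sub x u'x)) ¬uu' uz
    ... | yes uu' with OnSide⇒AtBlob uu'
    ...   | inj₂ ((x' , refl) , _) = ⊥-elim (leafSide-¬atLeastTwo (proj₁ ce') two')
    ...   | inj₁ u'S with v' ∈? S
    ...     | yes v'S = ⊥-elim (twoConnected-¬CutEdge tc u'S v'S ce')
    ...     | no v'∉S with IsLeaf? v'
    ...       | no v'-nonLeaf with only u' v' u'S v'∉S (ce' , twoConnected-¬leaf tc u'S , v'-nonLeaf)
    ...         | refl , refl = uz
    Side-minimal {u'} ce' two' sub z uz | yes uu' | inj₁ u'S | no v'∉S | yes (x' , refl) =
      let y , vy = cut-nonempty v u (CutEdge-flip ce)
          ¬uy = Side-disjoint ce vy
          y≢x' = λ { refl → ¬uy (ContainedIn⇒Side (u' , Adj-sym (proj₁ ce') , u'S)) }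
      in ⊥-elim (¬uy (sub y (Side-leafEdge-other (Adj-sym (proj₁ ce')) y≢x')))

  module MinimalSplitBlob (noCherries : NoCherries) {u v : Fin n} (ce : CutEdge u v)
           (two-u : AtLeastTwo (Side u v)) (two-v : AtLeastTwo (λ x → ¬ Side u v x))
           (minimal : ∀ {u' v'} → CutEdge u' v' → AtLeastTwo (Side u' v') → AtLeastTwo (λ x → ¬ Side u' v' x) →
                      (∀ x → Side u' v' x → Side u v x) → ∀ x → Side u v x → Side u' v' x) where

    private
      uv : Adj u v
      uv = proj₁ ce
      ¬uv : ¬ OnSide u v v
      ¬uv = proj₂ ce

    u-nonLeaf : ¬ IsLeaf u
    u-nonLeaf (x , refl) = leafSide-¬atLeastTwo uv two-u

    v-nonLeaf : ¬ IsLeaf v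
    v-nonLeaf (x , refl) = leafSide-¬atLeastTwo (Adj-sym uv) (AtLeastTwo-map (λ _ → OnSide-complement) two-v)

    -- The side of pq away from u lies inside the u-side, so by minimality pq would induce the split of uv.
    ¬cutAway : ∀ {p q} → OnSide u v p → OnSide u v q → ¬ IsLeaf p → CutEdge p q → ¬ OnSide p q u → ⊥
    ¬cutAway {p} {q} up uq ¬lp ce' ¬pu = ¬uv (subst (OnSide u v) (sym (proj₂ same)) uq)
      where
      p⊆u : ∀ x → Side p q x → Side u v x
      p⊆u x = OnSide-nested ce up ¬pu
      same : u ≡ p × v ≡ q
      same = cut-distinct u v p q ce ce' λ x →
        minimal ce' (nonLeaf-twoSides ce' ¬lp) (AtLeastTwo-map (λ y ¬uy py → ¬uy (p⊆u y py)) two-v) p⊆u x ,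
        p⊆u x

    ¬innerCut : ∀ {a b} → OnSide u v a → OnSide u v b → ¬ IsLeaf a → ¬ IsLeaf b → ¬ CutEdge a b
    ¬innerCut {a} {b} ua ub ¬la ¬lb ce' with OnSide? a b u
    ... | no ¬au = ¬cutAway ua ub ¬la ce' ¬au
    ... | yes au = ¬cutAway ub ua ¬lb (CutEdge-flip ce')
                     λ bu → proj₂ ce' (Reach-trans au (Reach-reverse Adj∖-sym (Reach-map Adj∖-flip bu)))

    detour : ∀ {a b} → OnSide u v a → OnSide u v b → ¬ IsLeaf a → ¬ IsLeaf b → Adj a b → OnSide a b b
    detour {a} {b} ua ub ¬la ¬lb ab with OnSide? a b b
    ... | yes r = r
    ... | no ¬r = ⊥-elim (¬innerCut ua ub ¬la ¬lb (ab , ¬r))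

    u-step : ∀ {w} → Adj u w → w ≢ v → OnSide u v w
    u-step uw w≢v =
      step (uw , λ { (inj₁ (_ , w≡v)) → w≢v w≡v ; (inj₂ (u≡v , _)) → Adj⇒≢ uv u≡v }) here

    -- If wa were a leaf, the edge u wb would be a cut-edge inside the u-side (or wa, wb would form a cherry).
    otherNeighbour-nonLeaf : ∀ {wa wb} → Adj u wa → Adj u wb → wa ≢ wb →
                             (∀ {t} → Adj u t → t ≡ v ⊎ t ≡ wa ⊎ t ≡ wb) → OnSide u v wb → ¬ IsLeaf wa
    otherNeighbour-nonLeaf {wa} {wb} ua ub a≢b cover u-wb (x , refl) with IsLeaf? wb
    ... | yes (y , refl) = noCherries (x , y , u , (λ { refl → a≢b refl }) , Adj-sym ua , Adj-sym ub)
    ... | no ¬lb = ¬innerCut here u-wb u-nonLeaf ¬lb (ub , no-detour)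
      where
      Near : Fin n → Set
      Near t = t ≡ u ⊎ t ≡ leaf x
      Near-step : ∀ {a b} → Near a → DelEdge (Adj∖ u wb) u v a b → Near b
      Near-step (inj₁ refl) ((e , ne₁) , ne₂) with cover e
      ... | inj₁ refl = ⊥-elim (ne₂ (inj₁ (refl , refl)))
      ... | inj₂ (inj₁ refl) = inj₂ refl
      ... | inj₂ (inj₂ refl) = ⊥-elim (ne₁ (inj₁ (refl , refl)))
      Near-step (inj₂ refl) ((e , _) , _) = inj₁ (leaf-adj-unique e (Adj-sym ua))
      ¬Near-wb : ¬ Near wb
      ¬Near-wb (inj₁ refl) = Adj⇒≢ ub refl
      ¬Near-wb (inj₂ refl) = a≢b refl
      no-detour : ¬ OnSide u wb wb
      no-detour r with Reach-delEdge u v r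
      ... | inj₁ r' = ¬Near-wb (Reach-preserves Near Near-step (inj₁ refl) r')
      ... | inj₂ (_ , inj₁ r') = ¬Near-wb (Reach-preserves Near Near-step (inj₁ refl) r')
      ... | inj₂ (_ , inj₂ r') = ¬uv (Reach-trans u-wb (Reach-reverse Adj∖-sym (Reach-map Adj∖∖⇒Adj∖ r')))

    open OtherNeighbours (otherNeighbours u-nonLeaf uv)

    w₁-nonLeaf : ¬ IsLeaf w₁
    w₁-nonLeaf = otherNeighbour-nonLeaf uw₁ uw₂ w₁≢w₂ cover (u-step uw₂ w₂≢v)

    w₂-nonLeaf : ¬ IsLeaf w₂
    w₂-nonLeaf = otherNeighbour-nonLeaf uw₂ uw₁ (≢-sym w₁≢w₂) swapped (u-step uw₁ w₁≢v)
      where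
      swapped : ∀ {t} → Adj u t → t ≡ v ⊎ t ≡ w₂ ⊎ t ≡ w₁
      swapped ut with cover ut
      ... | inj₁ eq = inj₁ eq
      ... | inj₂ (inj₁ eq) = inj₂ (inj₂ eq)
      ... | inj₂ (inj₂ eq) = inj₂ (inj₁ eq)

    Internal : Fin n → Set
    Internal t = OnSide u v t × ¬ IsLeaf t

    Internal? : Decidable Internal
    Internal? t = OnSide? u v t ×-dec ¬? (IsLeaf? t)

    S : Subset n
    S = subsetOf Internal?

    ∈S⁺ : ∀ {t} → OnSide u v t → ¬ IsLeaf t → t ∈ S
    ∈S⁺ ut ¬lt = ∈-subsetOf⁺ Internal? (ut , ¬lt)

    ∈S⁻ : ∀ {t} → t ∈ S → Internal t
    ∈S⁻ = ∈-subsetOf⁻ Internal?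

    u∈S : u ∈ S
    u∈S = ∈S⁺ here u-nonLeaf

    v∉S : v ∉ S
    v∉S vS = ¬uv (proj₁ (∈S⁻ vS))

    internalWalk : ∀ {E : Rel n} → (∀ {a b} → E a b → Adj∖ u v a b) → ∀ {a b} → a ∈ S → b ∈ S →
                   Reach E a b → Reach (Within (_∈ S) E) a b
    internalWalk f {a} aS bS r =
      Reach-map (λ { ((e , ua , ub) , ¬la , ¬lb) → e , ∈S⁺ ua ¬la , ∈S⁺ ub ¬lb })
        (Reach-avoidLeaves (λ { (e , _) → proj₁ (f e) }) (proj₂ (∈S⁻ aS)) (proj₂ (∈S⁻ bS))
          (Reach-within (OnSide u v) (λ ux e → Reach-snoc ux (f e)) (proj₁ (∈S⁻ aS)) r))

    u-reaches : ∀ {t} → t ∈ S → Reach (Induced S) u t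
    u-reaches tS =
      Reach-map (λ { ((e , _) , aS , bS) → e , aS , bS }) (internalWalk (λ e → e) u∈S tS (proj₁ (∈S⁻ tS)))

    -- The detour around an edge ab of S cannot use uv, so it stays on u's side.
    detour-in-S : ∀ {a b} → a ∈ S → b ∈ S → Adj a b → Reach (Within (_∈ S) (Adj∖ a b)) a b
    detour-in-S {a} {b} aS bS ab =
      Reach-map (λ { (e , xS , yS) → proj₁ e , xS , yS }) (internalWalk Adj∖∖⇒Adj∖ aS bS avoiding-uv)
      where
      ua : OnSide u v a
      ua = proj₁ (∈S⁻ aS)
      ub : OnSide u v b
      ub = proj₁ (∈S⁻ bS)
      avoiding-uv : Reach (DelEdge (Adj∖ a b) u v) a b
      avoiding-uv with Reach-delEdge u v (detour ua ub (proj₂ (∈S⁻ aS)) (proj₂ (∈S⁻ bS)) ab)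
      ... | inj₁ r = r
      ... | inj₂ (inj₂ av , _) = ⊥-elim (¬uv (Reach-trans ua (Reach-map Adj∖∖⇒Adj∖ av)))
      ... | inj₂ (inj₁ _ , inj₂ vb) = ⊥-elim (¬uv (Reach-trans ub (Reach-reverse Adj∖-sym (Reach-map Adj∖∖⇒Adj∖ vb))))
      ... | inj₂ (inj₁ au , inj₁ ub') = Reach-trans au ub'

    module _ {w : Fin n} (wS : w ∈ S) where

      avoid-w : ∀ {E : Rel n} → (∀ {x y} → E x y → Induced S x y) → ∀ {x y} →
                Within (λ t → ¬ t ≡ w) E x y → Induced∖ S w x y
      avoid-w f (e , x≢w , y≢w) = let (xy , xS , yS) = f e in Induced∖-edge xy xS yS x≢w y≢w

      -- Going around the edge wc inside S returns to w through another neighbour.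
      link : ∀ {c} → c ∈ S → Adj w c → ∃[ c' ] (c' ∈ S × Adj w c' × c' ≢ c × Reach (Induced∖ S w) c c')
      link {c} cS wc with Reach-firstEntry (_≡ w) (_≟ w) (Adj⇒≢ (Adj-sym wc))
                            (Reach-reverse (λ { (e , xS , yS) → Adj∖-sym e , yS , xS }) (detour-in-S wS cS wc))
      ... | inj₁ r = ⊥-elim (Reach-within-end r (Adj⇒≢ (Adj-sym wc)) refl)
      ... | inj₂ (c' , _ , r , ((c'w , ne) , c'S , _) , refl) =
            c' , c'S , Adj-sym c'w , (λ { refl → ne (inj₂ (refl , refl)) }) ,
            Reach-map (avoid-w {E = Within (_∈ S) (Adj∖ w c)} λ { ((e , _) , xS , yS) → e , xS , yS }) r

      -- Since w has only three neighbours, the links from c and from c' close up.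
      neighbours-linked : ∀ {c c'} → c ∈ S → c' ∈ S → Adj w c → Adj w c' → Reach (Induced∖ S w) c c'
      neighbours-linked {c} {c'} cS c'S wc wc' with c ≟ c'
      ... | yes refl = here
      ... | no c≢c' with link cS wc
      ...   | c₂ , _ , wc₂ , c₂≢c , r₁ with c₂ ≟ c'
      ...     | yes refl = r₁
      ...     | no c₂≢c' with link c'S wc'
      ...       | c₃ , _ , wc₃ , c₃≢c' , r₂ with c₃ ≟ c
      ...         | yes refl = Reach-reverse Induced∖-sym r₂
      ...         | no c₃≢c with c₃ ≟ c₂
      ...           | yes refl = Reach-trans r₁ (Reach-reverse Induced∖-sym r₂)
      ...           | no c₃≢c₂ = ⊥-elim (¬fourNeighbours wc wc₂ wc' wc₃
                                   (≢-sym c₂≢c) c≢c' (≢-sym c₃≢c) c₂≢c' (≢-sym c₃≢c₂) (≢-sym c₃≢c'))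

      reach-or-meet : ∀ {a b} → Minus S w a → Minus S w b →
                      Reach (Induced∖ S w) a b ⊎ ∃[ c ] (c ∈ S × Adj w c × Reach (Induced∖ S w) a c)
      reach-or-meet (aS , a≢w) (bS , _)
        with Reach-firstEntry (_≡ w) (_≟ w) a≢w (Reach-trans (Reach-reverse Induced-sym (u-reaches aS)) (u-reaches bS))
      ... | inj₁ r = inj₁ (Reach-map (avoid-w (λ e → e)) r)
      ... | inj₂ (c , _ , r , (cw , cS , _) , refl) = inj₂ (c , cS , Adj-sym cw , Reach-map (avoid-w (λ e → e)) r)

      connected∖ : Connected (Minus S w) (Induced∖ S w)
      connected∖ a b a-w b-w with reach-or-meet a-w b-w
      ... | inj₁ r = r
      ... | inj₂ (c , cS , wc , ac) with reach-or-meet b-w a-w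
      ...   | inj₁ r = Reach-reverse Induced∖-sym r
      ...   | inj₂ (c' , c'S , wc' , bc') =
              Reach-trans ac (Reach-trans (neighbours-linked cS c'S wc wc') (Reach-reverse Induced∖-sym bc'))

    S-twoConnected : TwoConnected S
    S-twoConnected =
      three≤∣p∣ u∈S (∈S⁺ (u-step uw₁ w₁≢v) w₁-nonLeaf) (∈S⁺ (u-step uw₂ w₂≢v) w₂-nonLeaf)
                (Adj⇒≢ uw₁) (Adj⇒≢ uw₂) w₁≢w₂ ,
      (λ a b aS bS → Reach-trans (Reach-reverse Induced-sym (u-reaches aS)) (u-reaches bS)) ,
      λ w wS → connected∖ wS

    -- A 2-connected superset cannot contain v (uv would not be a cut-edge), so it stays on u's side.
    S-maximal : ∀ S' → S ⊆ S' → TwoConnected S' → S' ⊆ S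
    S-maximal S' S⊆S' tc' {t} tS' with v ∈? S'
    ... | yes vS' = ⊥-elim (twoConnected-¬CutEdge tc' (S⊆S' u∈S) vS' ce)
    ... | no v∉S' =
      ∈S⁺ (Reach-map avoid-uv (proj₁ (proj₂ tc') u t (S⊆S' u∈S) tS')) (twoConnected-¬leaf tc' tS')
      where
      avoid-uv : ∀ {a b} → Induced S' a b → Adj∖ u v a b
      avoid-uv (e , aS , bS) = e , λ { (inj₁ (_ , refl)) → v∉S' bS ; (inj₂ (refl , _)) → v∉S' aS }

    S-pendant : PendantBlob S
    S-pendant = (S-twoConnected , S-maximal) , u , v , (u∈S , v∉S , ce , u-nonLeaf , v-nonLeaf) , only
      where
      only : ∀ u' v' → u' ∈ S → v' ∉ S → NonTrivCut u' v' → u' ≡ u × v' ≡ v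
      only u' v' u'S v'∉S (ce' , _ , ¬lv') with SameEdge? u' v' u v
      ... | yes (inj₁ same) = same
      ... | yes (inj₂ (refl , _)) = ⊥-elim (v∉S u'S)
      ... | no ne = ⊥-elim (v'∉S (∈S⁺ (Reach-snoc (proj₁ (∈S⁻ u'S)) (proj₁ ce' , ne)) ¬lv'))

    Side⇒ContainedIn : ∀ {x} → Side u v x → ContainedIn x S
    Side⇒ContainedIn {x} ux =
      let p , xp = leaf-neighbour x
          ne = λ { (inj₁ (x≡u , _)) → u-nonLeaf (x , x≡u) ; (inj₂ (x≡v , _)) → v-nonLeaf (x , x≡v) }
      in p , xp , ∈S⁺ (Reach-snoc ux (xp , ne)) (leaf-adj-nonLeaf u-nonLeaf xp)

    ContainedIn⇒Side : ∀ {x} → ContainedIn x S → Side u v x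
    ContainedIn⇒Side {x} (w , xw , wS) =
      Reach-snoc (proj₁ (∈S⁻ wS))
        (Adj-sym xw , λ { (inj₁ (_ , x≡v)) → v-nonLeaf (x , x≡v) ; (inj₂ (refl , _)) → v∉S wS })

  _≐_ : (Fin m → Set) → Subset m → Set
  P ≐ A = ∀ x → (x ∈ A → P x) × (P x → x ∈ A)

  PendantLeafSet : Subset m → Set
  PendantLeafSet A = ∃[ S ] (PendantBlob S × (λ x → ContainedIn x S) ≐ A)

  MinimalSplit : Subset m → Set
  MinimalSplit A =
    (∃[ u ] ∃[ v ] (CutEdge u v × Side u v ≐ A)) × AtLeastTwo (_∈ A) × AtLeastTwo (_∉ A) ×
    (∀ u' v' → CutEdge u' v' → AtLeastTwo (Side u' v') → AtLeastTwo (λ x → ¬ Side u' v' x) →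
               ¬ StrictSub (Side u' v') A)

  pendantBlob-atLeastTwoLeaves : ∀ {S} → PendantBlob S → AtLeastTwo (λ x → ContainedIn x S)
  pendantBlob-atLeastTwoLeaves (blob , _ , _ , (uS , v∉S , ce , _ , ¬lv) , only) =
    PendantBlobSide.atLeastTwo-contained blob uS v∉S ce ¬lv only

  -- The leaves outside A include those of a second pendant blob.
  pendantLeafSet⇒minimalSplit : AtLeastTwoPendant → ∀ A → PendantLeafSet A → MinimalSplit A
  pendantLeafSet⇒minimalSplit (S₁ , S₂ , S₁≢S₂ , pb₁ , pb₂) A
    (S , (blob , u , v , (uS , v∉S , ce , _ , ¬lv) , only) , leaves) =
    (u , v , ce , λ x → ContainedIn⇒Side ∘ proj₁ (leaves x) , proj₂ (leaves x) ∘ Side⇒ContainedIn) ,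
    AtLeastTwo-map (λ x → proj₂ (leaves x)) atLeastTwo-contained ,
    outside (other-pendant (≡-dec Bool._≟_ S S₁)) ,
    λ u' v' ce' two' _ (sub , z , zA , ¬u'z) →
      ¬u'z (Side-minimal ce' two' (λ x → ContainedIn⇒Side ∘ proj₁ (leaves x) ∘ sub x)
                         z (ContainedIn⇒Side (proj₁ (leaves z) zA)))
    where
    open PendantBlobSide blob uS v∉S ce ¬lv only
    other-pendant : Dec (S ≡ S₁) → ∃[ T ] (PendantBlob T × T ≢ S)
    other-pendant (yes refl) = S₂ , pb₂ , ≢-sym S₁≢S₂
    other-pendant (no S≢S₁) = S₁ , pb₁ , ≢-sym S≢S₁
    outside : ∃[ T ] (PendantBlob T × T ≢ S) → AtLeastTwo (_∉ A)
    outside (T , pbT , T≢S) =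
      AtLeastTwo-map (λ x inT xA → contained-disjoint (proj₁ pbT) T≢S inT (proj₁ (leaves x) xA))
                     (pendantBlob-atLeastTwoLeaves pbT)

  minimalSplit⇒pendantLeafSet : NoCherries → ∀ A → MinimalSplit A → PendantLeafSet A
  minimalSplit⇒pendantLeafSet noCherries A ((u , v , ce , side) , two-in , two-out , ¬strict) =
    S , S-pendant , λ x → Side⇒ContainedIn ∘ proj₁ (side x) , proj₂ (side x) ∘ ContainedIn⇒Side
    where
    minimal : ∀ {u' v'} → CutEdge u' v' → AtLeastTwo (Side u' v') → AtLeastTwo (λ x → ¬ Side u' v' x) →
              (∀ x → Side u' v' x → Side u v x) → ∀ x → Side u v x → Side u' v' x
    minimal {u'} {v'} ce' two' two'' sub x ux with Side? u' v' x
    ... | yes u'x = u'x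
    ... | no ¬u'x = ⊥-elim (¬strict u' v' ce' two' two''
                      ((λ y → proj₂ (side y) ∘ sub y) , x , proj₂ (side x) ux , ¬u'x))
    open MinimalSplitBlob noCherries ce (AtLeastTwo-map (λ x → proj₁ (side x)) two-in)
           (AtLeastTwo-map (λ x x∉A ux → x∉A (proj₂ (side x) ux)) two-out) minimal

lemma5 : ∀ {m} (N : Network m) → Network.Level2 N → Network.NoCherries N →
         Network.AtLeastTwoPendant N → (A : Subset m) →
         (∃[ S ] (Network.PendantBlob N S ×
                  (∀ x → (x ∈ A → Network.ContainedIn N x S) × (Network.ContainedIn N x S → x ∈ A))))
         ⇔
         ((∃[ u ] ∃[ v ] (Network.CutEdge N u v ×
                  (∀ x → (x ∈ A → Network.Side N u v x) × (Network.Side N u v x → x ∈ A)))) ×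
          AtLeastTwo (_∈ A) × AtLeastTwo (_∉ A) ×
          (∀ u' v' → Network.CutEdge N u' v' → AtLeastTwo (Network.Side N u' v') →
                     AtLeastTwo (λ x → ¬ Network.Side N u' v' x) →
                     ¬ StrictSub (Network.Side N u' v') A))
lemma5 N _ noCherries twoPendant A =
  mk⇔ (pendantLeafSet⇒minimalSplit N twoPendant A) (minimalSplit⇒pendantLeafSet N noCherries A)
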